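{- Every sequence $a_1,a_2,\dotsc$ in a semigroup has a sumsequence $b_1,b_2,\dotsc$ of one of the following types: (1) for all natural numbers $n<m$, $b_n+b_m=b_n$; (2) for all natural numbers $n$, $\mathrm{FS}(b_1,\dotsc,b_n)\cap(\mathrm{FS}(b_1,\dotsc,b_n)+b_{n+1})=\emptyset$.
   Context: Semigroups are written additively. For a sequence $c_1,c_2,\dotsc$ and nonempty finite $F=\{i_1<\dotsb<i_m\}\subseteq\mathbb{N}$, $c_F:=c_{i_1}+\dotsb+c_{i_m}$; $\mathrm{FS}(c_1,\dotsc,c_n):=\{c_F: \emptyset\neq F\subseteq\{1,\dotsc,n\}\}$, and $X+y:=\{x+y:x\in X\}$. $F_1<F_2$ means every element of $F_1$ is smaller than every element of $F_2$. A sumsequence of $c_1,c_2,\dotsc$ is a sequence $c_{F_1},c_{F_2},\dotsc$ for nonempty finite $F_1<F_2<\dotsb$. -}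

module Defs where

open import Level using (Level)
open import Data.Nat using (ℕ; suc; _<_)
open import Data.List.NonEmpty using (List⁺; _∷_; head; last; toList)
open import Data.List using (List; []; _∷_)
open import Data.List.Relation.Unary.Linked using (Linked)
open import Data.Product using (Σ; _×_; ∃)
open import Relation.Nullary using (¬_)
open import Algebra.Bundles using (Semigroup)

-- A nonempty finite set F ⊆ ℕ, represented as its strictly increasing
-- (nonempty) list of elements.
record FinSet⁺ : Set where
  constructor mkFinSet⁺
  field
    elems : List⁺ ℕ
    incr  : Linked _<_ (toList elems)
open FinSet⁺ public

minF : FinSet⁺ → ℕ
minF F = head (elems F)

maxF : FinSet⁺ → ℕ
maxF F = last (elems F)

_≺_ : FinSet⁺ → FinSet⁺ → Set
F ≺ G = maxF F < minF G

module _ {c ℓ : Level} (S : Semigroup c ℓ) where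
  open Semigroup S

  sumFrom : (ℕ → Carrier) → ℕ → List ℕ → Carrier
  sumFrom a i []       = a i
  sumFrom a i (j ∷ js) = a i ∙ sumFrom a j js

  sumL : (ℕ → Carrier) → List⁺ ℕ → Carrier
  sumL a (i ∷ is) = sumFrom a i is

  sumF : (ℕ → Carrier) → FinSet⁺ → Carrier
  sumF a F = sumL a (elems F)

  -- b is the sumsequence of a determined by blocks F₀ < F₁ < F₂ < ⋯ (0-indexed)
  Blocks : (ℕ → FinSet⁺) → Set
  Blocks F = ∀ k → F k ≺ F (suc k)

  sumseq : (ℕ → Carrier) → (ℕ → FinSet⁺) → (ℕ → Carrier)
  sumseq a F k = sumF a (F k)

  Type1 : (ℕ → Carrier) → Set ℓ
  Type1 b = ∀ n m → n < m → (b n ∙ b m) ≈ b n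

  -- type (2): FS(b_0,…,b_{n-1}) ∩ (FS(b_0,…,b_{n-1}) + b_n) = ∅ for every n
  -- (0-indexed version of FS(b_1..b_n) ∩ (FS(b_1..b_n)+b_{n+1}) = ∅)
  Type2 : (ℕ → Carrier) → Set ℓ
  Type2 b = ∀ n (G H : FinSet⁺) → maxF G < n → maxF H < n →
            ¬ (sumF b G ≈ (sumF b H ∙ b n))

-- Call a sumsequence d of a absorbing if some finite sum x of its terms
-- absorbs every term of a further sumsequence d′ of d (x + d′ₘ = x). If every
-- sumsequence is absorbing, iterating yields x₀, x₁, … with each xₙ absorbing all
-- later ones: type (1). Otherwise fix a non-absorbing d and choose the blocks
-- bₙ = dₜ + ⋯ + dₜ₊ₗ greedily, each one avoiding every relation
-- g = h + bₙ with g, h ∈ FS(b₀,…,bₙ₋₁). A suitable length l exists, for otherwise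
-- infinitely many l would share the same pair (g, h) by pigeonhole, and then g
-- absorbs the sums of d between two consecutive such lengths, making d absorbing.
module Submission where

open import Defs
open import Level using (_⊔_)
open import Data.Nat using (ℕ; zero; suc; _+_; _≤_; _<_; _≤′_; ≤′-reflexive; ≤′-step; z≤n; s≤s; _<?_)
open import Data.Nat.Properties
open import Data.Sum using (_⊎_; inj₁; inj₂)
open import Data.Product using (Σ; ∃; _×_; _,_; proj₁; proj₂)
open import Data.List using (List; []; _∷_; _++_; map)
import Data.List as List
open import Data.List.NonEmpty using (_∷_; last)
open import Data.List.Relation.Unary.Linked using (Linked; [-]; _∷_)
open import Data.List.Relation.Unary.Any using (Any; here; there; satisfied)
import Data.List.Relation.Unary.Any as Any
open import Data.List.Relation.Unary.Any.Properties using (map⁺; ++⁺ˡ; ++⁺ʳ)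
open import Data.Empty using (⊥-elim)
open import Relation.Nullary using (¬_; yes; no)
open import Relation.Binary.PropositionalEquality using (_≡_; refl; sym; trans; cong; cong₂; subst; subst₂)
open import Function using (case_of_)
open import Algebra.Bundles using (Semigroup)
open import Axiom.ExcludedMiddle using (ExcludedMiddle)
open import Axiom.DoubleNegationElimination using (em⇒dne)

private
  lastFrom : ℕ → List ℕ → ℕ
  lastFrom i []       = i
  lastFrom i (j ∷ js) = lastFrom j js

  lastFrom-∷ʳ : ∀ i xs y → lastFrom i (xs List.∷ʳ y) ≡ y
  lastFrom-∷ʳ i []       y = refl
  lastFrom-∷ʳ i (x ∷ xs) y = lastFrom-∷ʳ x xs y

  last≡lastFrom : ∀ i is → last (i ∷ is) ≡ lastFrom i is
  last≡lastFrom i is with List.initLast is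
  ... | List.[]         = refl
  ... | xs List.∷ʳ′ y = sym (lastFrom-∷ʳ i xs y)

last-∷∷ : ∀ i j js → last (i ∷ j ∷ js) ≡ last (j ∷ js)
last-∷∷ i j js = trans (last≡lastFrom i (j ∷ js)) (sym (last≡lastFrom j js))

head≤last : ∀ {i is} → Linked _<_ (i ∷ is) → i ≤ last (i ∷ is)
head≤last [-]                       = ≤-refl
head≤last {i} {j ∷ js} (i<j ∷ L) =
  ≤-trans (<⇒≤ i<j) (subst (_ ≤_) (sym (last-∷∷ i j js)) (head≤last L))

last-++ : ∀ i is k ks → last (i ∷ is ++ k ∷ ks) ≡ last (k ∷ ks)
last-++ i []       k ks = last-∷∷ i k ks
last-++ i (j ∷ js) k ks = trans (last-∷∷ i j (js ++ k ∷ ks)) (last-++ j js k ks)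

Linked-++ : ∀ {i is k ks} → Linked _<_ (i ∷ is) → last (i ∷ is) < k → Linked _<_ (k ∷ ks) →
            Linked _<_ (i ∷ is ++ k ∷ ks)
Linked-++ {is = []}     [-]         i<k L₂ = i<k ∷ L₂
Linked-++ {i} {j ∷ js} (i<j ∷ L₁) h   L₂ = i<j ∷ Linked-++ L₁ (subst (_< _) (last-∷∷ i j js) h) L₂

record Block (p q : ℕ) : Set where
  constructor mkBlock
  field
    set   : FinSet⁺
    lower : p ≤ minF set
    upper : maxF set < q
open Block

Block⇒< : ∀ {p q} → Block p q → p < q
Block⇒< (mkBlock (mkFinSet⁺ (i ∷ is) L) lower upper) = ≤-<-trans lower (≤-<-trans (head≤last L) upper)

weaken : ∀ {p p′ q q′} → p′ ≤ p → q ≤ q′ → Block p q → Block p′ q′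
weaken p′≤p q≤q′ (mkBlock F lower upper) = mkBlock F (≤-trans p′≤p lower) (<-≤-trans upper q≤q′)

singleton : ∀ k → Block k (suc k)
singleton k = mkBlock (mkFinSet⁺ (k ∷ []) [-]) ≤-refl ≤-refl

_⊕_ : ∀ {p q r} → Block p q → Block q r → Block p r
mkBlock (mkFinSet⁺ (i ∷ is) L₁) lower₁ upper₁ ⊕ mkBlock (mkFinSet⁺ (k ∷ ks) L₂) lower₂ upper₂ =
  mkBlock (mkFinSet⁺ (i ∷ is ++ k ∷ ks) (Linked-++ L₁ (<-≤-trans upper₁ lower₂) L₂))
        lower₁ (subst (_< _) (sym (last-++ i is k ks)) upper₂)

InfOften : ∀ {r} → (ℕ → Set r) → Set r
InfOften P = ∀ m → ∃ λ g → P (m + g)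

infOften-map : ∀ {r s} {P : ℕ → Set r} {Q : ℕ → Set s} → (∀ {l} → P l → Q l) → InfOften P → InfOften Q
infOften-map f h m = proj₁ (h m) , f (proj₂ (h m))

record Recurrence {r} (P : ℕ → Set r) : Set r where
  field
    index : ℕ → ℕ
    gap   : ℕ → ℕ
    holds : ∀ n → P (index n)
    next  : ∀ n → index (suc n) ≡ suc (gap n) + index n

infOften⇒recurrence : ∀ {r} {P : ℕ → Set r} → InfOften P → Recurrence P
infOften⇒recurrence {P = P} h = record { index = index ; gap = gap ; holds = holds ; next = λ _ → refl }
  where
  index gap : ℕ → ℕ
  index zero    = proj₁ (h 0)
  index (suc n) = suc (gap n) + index n
  gap n = proj₁ (h (suc (index n)))

  holds : ∀ n → P (index n)
  holds zero    = proj₂ (h 0)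
  holds (suc n) = subst P (cong suc (+-comm (index n) (gap n))) (proj₂ (h (suc (index n))))

module Classical (em : ∀ {a} → ExcludedMiddle a) where

  dne : ∀ {r} {P : Set r} → ¬ ¬ P → P
  dne = em⇒dne em

  infOften-⊎ : ∀ {r s} {P : ℕ → Set r} {Q : ℕ → Set s} →
               InfOften (λ l → P l ⊎ Q l) → InfOften P ⊎ InfOften Q
  infOften-⊎ {P = P} {Q} h with em {P = InfOften P}
  ... | yes infP = inj₁ infP
  ... | no ¬infP = inj₂ infQ
    where
    eventuallyNot : ∃ λ m₀ → ∀ g → ¬ P (m₀ + g)
    eventuallyNot = dne λ ¬ev → ¬infP λ m → dne λ ¬Pm → ¬ev (m , λ g p → ¬Pm (g , p))

    infQ : InfOften Q
    infQ m with eventuallyNot | h (proj₁ eventuallyNot + m)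
    ... | m₀ , ¬P | g , inj₁ p = ⊥-elim (¬P (m + g) (subst P (+-assoc m₀ m g) p))
    ... | m₀ , ¬P | g , inj₂ q = m₀ + g , subst Q (shuffle m₀ m g) q
      where
      shuffle : ∀ x y z → x + y + z ≡ y + (x + z)
      shuffle x y z = trans (cong (_+ z) (+-comm x y)) (+-assoc y x z)

  infOften-Any : ∀ {A : Set} {r} {R : ℕ → A → Set r} {xs : List A} →
                 InfOften (λ l → Any (R l) xs) → Any (λ x → InfOften (λ l → R l x)) xs
  infOften-Any {xs = []} h with h 0
  ... | _ , ()
  infOften-Any {R = R} {x ∷ xs} h
    with infOften-⊎ {P = λ l → R l x} {Q = λ l → Any (R l) xs}
                    (infOften-map (λ {l} → Any.toSum {P = R l} {x} {xs}) h)
  ... | inj₁ infx  = here infx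
  ... | inj₂ infxs = there (infOften-Any {R = R} infxs)

-- Dependent choice in which the value chosen at n may depend on the values below n.
module PrefixChoice {A : Set} {r} (P : (ℕ → A) → ℕ → A → Set r)
                    (P-local : ∀ {f g n v} → (∀ k → k < n → f k ≡ g k) → P f n v → P g n v)
                    (choose : ∀ f n → Σ A (P f n)) (a₀ : A) where

  private
    extend : (ℕ → A) → ℕ → A → ℕ → A
    extend f n v k with k <? n
    ... | yes _ = f k
    ... | no  _ = v

    extend-below : ∀ f n v k → k < n → extend f n v k ≡ f k
    extend-below f n v k k<n with k <? n
    ... | yes _   = refl
    ... | no  k≮n = ⊥-elim (k≮n k<n)

    extend-at : ∀ f n v → extend f n v n ≡ v
    extend-at f n v with n <? n
    ... | yes n<n = ⊥-elim (<-irrefl refl n<n)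
    ... | no  _   = refl

    approx : ℕ → ℕ → A
    approx zero    = λ _ → a₀
    approx (suc n) = extend (approx n) n (proj₁ (choose (approx n) n))

  choice : ℕ → A
  choice k = approx (suc k) k

  private
    approx-agrees : ∀ n k → k < n → approx n k ≡ choice k
    approx-agrees (suc n) k (s≤s k≤n) with m≤n⇒m<n∨m≡n k≤n
    ... | inj₁ k<n  = trans (extend-below (approx n) n _ k k<n) (approx-agrees n k k<n)
    ... | inj₂ refl = refl

  choice-spec : ∀ n → P choice n (choice n)
  choice-spec n = subst (P choice n) (sym (extend-at (approx n) n _))
                    (P-local (approx-agrees n) (proj₂ (choose (approx n) n)))

module Sumsequences {c ℓ} (S : Semigroup c ℓ) (a : ℕ → Semigroup.Carrier S) where
  open Semigroup S renaming (refl to ≈-refl; sym to ≈-sym; trans to ≈-trans)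
  open import Relation.Binary.Reasoning.Setoid setoid

  sumFrom-++ : ∀ (u : ℕ → Carrier) i js k ks →
               sumFrom S u i (js ++ k ∷ ks) ≈ sumFrom S u i js ∙ sumFrom S u k ks
  sumFrom-++ u i []       k ks = ≈-refl
  sumFrom-++ u i (j ∷ js) k ks = ≈-trans (∙-congˡ (sumFrom-++ u j js k ks)) (≈-sym (assoc _ _ _))

  sumF-local : ∀ {u v : ℕ → Carrier} {n} → (∀ j → j < n → u j ≡ v j) →
               ∀ G → maxF G < n → sumF S u G ≡ sumF S v G
  sumF-local {u} {v} {n} u≡v (mkFinSet⁺ (i ∷ is) L) = go L
    where
    go : ∀ {i is} → Linked _<_ (i ∷ is) → last (i ∷ is) < n → sumFrom S u i is ≡ sumFrom S v i is
    go {i} [-]                   i<n   = u≡v i i<n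
    go {i} {j ∷ js} (i<j ∷ L) max<n =
      cong₂ _∙_ (u≡v i (<-≤-trans i<j (<⇒≤ (≤-<-trans (head≤last L) tail<n)))) (go L tail<n)
      where
      tail<n = subst (_< n) (last-∷∷ i j js) max<n

  val : ∀ {p q} → Block p q → Carrier
  val x = sumF S a (set x)

  val-⊕ : ∀ {p q r} (x : Block p q) (y : Block q r) → val (x ⊕ y) ≈ val x ∙ val y
  val-⊕ (mkBlock (mkFinSet⁺ (i ∷ is) _) _ _) (mkBlock (mkFinSet⁺ (k ∷ ks) _) _ _) = sumFrom-++ a i is k ks

  record Sumseq : Set where
    field
      bound : ℕ → ℕ
      block : ∀ k → Block (bound k) (bound (suc k))

    term : ℕ → Carrier
    term k = val (block k)
  open Sumseq

  singletons : Sumseq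
  singletons = record { bound = λ k → k ; block = singleton }

  data Generated (s : Sumseq) : Carrier → Set (c ⊔ ℓ) where
    gen-term : ∀ k → Generated s (term s k)
    gen-∙    : ∀ {y z} → Generated s y → Generated s z → Generated s (y ∙ z)
    gen-≈    : ∀ {y z} → Generated s y → y ≈ z → Generated s z

  generated-⊆ : ∀ {s s′} → (∀ k → Generated s (term s′ k)) → ∀ {y} → Generated s′ y → Generated s y
  generated-⊆ terms (gen-term k) = terms k
  generated-⊆ terms (gen-∙ g h)  = gen-∙ (generated-⊆ terms g) (generated-⊆ terms h)
  generated-⊆ terms (gen-≈ g q)  = gen-≈ (generated-⊆ terms g) q

  absorbs-generated : ∀ {s x} → (∀ k → x ∙ term s k ≈ x) → ∀ {y} → Generated s y → x ∙ y ≈ x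
  absorbs-generated absorbs (gen-term k) = absorbs k
  absorbs-generated {x = x} absorbs (gen-∙ {y} {z} g h) = begin
    x ∙ (y ∙ z) ≈⟨ assoc x y z ⟨
    (x ∙ y) ∙ z ≈⟨ ∙-congʳ (absorbs-generated absorbs g) ⟩
    x ∙ z       ≈⟨ absorbs-generated absorbs h ⟩
    x           ∎
  absorbs-generated absorbs (gen-≈ g q) = ≈-trans (∙-congˡ (≈-sym q)) (absorbs-generated absorbs g)

  bound-mono : ∀ s {i j} → i ≤′ j → bound s i ≤ bound s j
  bound-mono s (≤′-reflexive refl) = ≤-refl
  bound-mono s (≤′-step {j} i≤′j)  = ≤-trans (bound-mono s i≤′j) (<⇒≤ (Block⇒< (block s j)))

  module _ (s : Sumseq) where

    interval : ∀ j l → Block (bound s j) (bound s (suc l + j))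
    interval j zero    = block s j
    interval j (suc l) = interval j l ⊕ block s (suc l + j)

    interval-generated : ∀ j l → Generated s (val (interval j l))
    interval-generated j zero    = gen-term j
    interval-generated j (suc l) =
      gen-≈ (gen-∙ (interval-generated j l) (gen-term (suc l + j)))
            (≈-sym (val-⊕ (interval j l) (block s (suc l + j))))

    interval-split : ∀ j l g →
                     val (interval j (suc g + l)) ≈ val (interval j l) ∙ val (interval (suc l + j) g)
    interval-split j l zero    = val-⊕ (interval j l) (block s (suc l + j))
    interval-split j l (suc g) = begin
      val (interval j (suc (suc g + l)))
        ≈⟨ val-⊕ (interval j (suc g + l)) (block s (suc (suc g + l) + j)) ⟩
      val (interval j (suc g + l)) ∙ term s (suc (suc g + l) + j)
        ≈⟨ ∙-cong (interval-split j l g) (reflexive (cong (term s) index)) ⟩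
      (val (interval j l) ∙ val (interval (suc l + j) g)) ∙ term s (suc g + (suc l + j))
        ≈⟨ assoc _ _ _ ⟩
      val (interval j l) ∙ (val (interval (suc l + j) g) ∙ term s (suc g + (suc l + j)))
        ≈⟨ ∙-congˡ (val-⊕ (interval (suc l + j) g) (block s (suc g + (suc l + j)))) ⟨
      val (interval j l) ∙ val (interval (suc l + j) (suc g)) ∎
      where
      index : suc (suc g + l) + j ≡ suc g + (suc l + j)
      index = cong suc (trans (cong suc (+-assoc g l j)) (sym (+-suc g (l + j))))

    groupStart : (ℕ → ℕ) → ℕ → ℕ
    groupStart f zero    = 0
    groupStart f (suc k) = suc (f k) + groupStart f k

    group : (ℕ → ℕ) → Sumseq
    group f = record
      { bound = λ k → bound s (groupStart f k)
      ; block = λ k → interval (groupStart f k) (f k)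
      }

    raise : ∀ {m} k → Block (bound s (suc m)) (bound s (k + suc m)) →
                      Block (bound s (suc m)) (bound s (suc k + m))
    raise {m} k = weaken ≤-refl (≤-reflexive (cong (bound s) (+-suc k m)))

    -- All sums of sets of terms with indices in [m, k + m), as blocks.
    finiteSums : ∀ m k → List (Block (bound s m) (bound s (k + m)))
    finiteSums m zero    = []
    finiteSums m (suc k) =
      weaken ≤-refl (bound-mono s (≤⇒≤′ (s≤s (m≤n+m m k)))) (block s m)
        ∷ map (λ x → block s m ⊕ raise k x) (finiteSums (suc m) k)
        ++ map (λ x → weaken (<⇒≤ (Block⇒< (block s m))) ≤-refl (raise k x)) (finiteSums (suc m) k)

    Represents : Carrier → ∀ {p q} → Block p q → Set (c ⊔ ℓ)
    Represents v x = Generated s (val x) × val x ≈ v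

    finiteSums-complete : ∀ k m (G : FinSet⁺) → m ≤ minF G → maxF G < k + m →
                          Any (Represents (sumF S (term s) G)) (finiteSums m k)
    finiteSums-complete zero m (mkFinSet⁺ (i ∷ is) L) m≤i max<m =
      ⊥-elim (<-irrefl refl (≤-<-trans m≤i (≤-<-trans (head≤last L) max<m)))
    finiteSums-complete (suc k) m (mkFinSet⁺ (i ∷ is) L) m≤i max< with m≤n⇒m<n∨m≡n m≤i
    finiteSums-complete (suc k) m (mkFinSet⁺ (.m ∷ []) [-]) _ _ | inj₂ refl =
      here (gen-term m , ≈-refl)
    finiteSums-complete (suc k) m (mkFinSet⁺ (.m ∷ j ∷ js) (m<j ∷ L)) _ max< | inj₂ refl =
      there (++⁺ˡ (map⁺ (Any.map (λ {x} → prepend {x})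
        (finiteSums-complete k (suc m) (mkFinSet⁺ (j ∷ js) L) m<j
          (subst₂ _<_ (last-∷∷ m j js) (sym (+-suc k m)) max<)))))
      where
      prepend : ∀ {x} → Represents (sumFrom S (term s) j js) x →
                Represents (term s m ∙ sumFrom S (term s) j js) (block s m ⊕ raise k x)
      prepend {x} (gx , x≈) = gen-≈ (gen-∙ (gen-term m) gx) (≈-sym (val-⊕ (block s m) (raise k x)))
                            , ≈-trans (val-⊕ (block s m) (raise k x)) (∙-congˡ x≈)
    finiteSums-complete (suc k) m G _ max< | inj₁ m<i =
      there (++⁺ʳ _ (map⁺ (finiteSums-complete k (suc m) G m<i
        (subst (maxF G <_) (sym (+-suc k m)) max<))))

  blockSets : Sumseq → ℕ → FinSet⁺
  blockSets s k = set (block s k)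

  blockSets-blocks : ∀ s → Blocks S (blockSets s)
  blockSets-blocks s k = <-≤-trans (upper (block s k)) (lower (block s (suc k)))

  record Absorber (s : Sumseq) : Set (c ⊔ ℓ) where
    field
      {end}               : ℕ
      absorbing           : Block (bound s 0) end
      absorbing-generated : Generated s (val absorbing)
      absorbed            : Sumseq
      end≤                : end ≤ bound absorbed 0
      absorbed-generated  : ∀ k → Generated s (term absorbed k)
      absorbs             : ∀ k → val absorbing ∙ term absorbed k ≈ val absorbing

  absorbers⇒type1 : (∀ s → Absorber s) → Σ Sumseq λ t → Type1 S (term t)
  absorbers⇒type1 absorber = absorbings , absorbings-type1
    where
    open Absorber

    tower : ℕ → Sumseq
    tower zero    = singletons
    tower (suc n) = absorbed (absorber (tower n))

    generated-tower : ∀ {n m} → n ≤′ m → ∀ {y} → Generated (tower m) y → Generated (tower n) y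
    generated-tower (≤′-reflexive refl) g = g
    generated-tower (≤′-step {m} n≤′m) g =
      generated-tower n≤′m (generated-⊆ (absorbed-generated (absorber (tower m))) g)

    absorbings : Sumseq
    absorbings = record
      { bound = λ n → bound (tower n) 0
      ; block = λ n → weaken ≤-refl (end≤ (absorber (tower n))) (absorbing (absorber (tower n)))
      }

    absorbings-type1 : Type1 S (term absorbings)
    absorbings-type1 n m n<m =
      absorbs-generated (absorbs (absorber (tower n)))
        (generated-tower (≤⇒≤′ n<m) (absorbing-generated (absorber (tower m))))

  -- If x = y + (sₜ + ⋯ + sₜ₊ₗ) for infinitely many l, then x absorbs the sums of s
  -- between two consecutive such l.
  absorber-from-recurrence : ∀ s T {r} (x y : Block (bound s 0) r) → r ≤ bound s T → Generated s (val x) →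
                             InfOften (λ l → val x ≈ val y ∙ val (interval s T l)) → Absorber s
  absorber-from-recurrence s T x y r≤T gx recurs = record
    { absorbing           = x
    ; absorbing-generated = gx
    ; absorbed            = absorbed
    ; end≤                = ≤-trans r≤T (<⇒≤ (Block⇒< (interval s T (index 0))))
    ; absorbed-generated  = λ n → interval-generated s (suc (index n) + T) (gap n)
    ; absorbs             = absorbs
    }
    where
    open Recurrence (infOften⇒recurrence {P = λ l → val x ≈ val y ∙ val (interval s T l)} recurs)

    shift : ∀ n → suc (gap n) + (suc (index n) + T) ≡ suc (index (suc n)) + T
    shift n = trans (sym (+-assoc (suc (gap n)) (suc (index n)) T))
                    (cong (λ i → suc i + T) (trans (+-suc (gap n) (index n)) (sym (next n))))

    absorbed : Sumseq
    absorbed = record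
      { bound = λ n → bound s (suc (index n) + T)
      ; block = λ n → weaken ≤-refl (≤-reflexive (cong (bound s) (shift n)))
                             (interval s (suc (index n) + T) (gap n))
      }

    absorbs : ∀ n → val x ∙ val (interval s (suc (index n) + T) (gap n)) ≈ val x
    absorbs n = ≈-sym (begin
      val x
        ≈⟨ holds (suc n) ⟩
      val y ∙ val (interval s T (index (suc n)))
        ≡⟨ cong (λ i → val y ∙ val (interval s T i)) (next n) ⟩
      val y ∙ val (interval s T (suc (gap n) + index n))
        ≈⟨ ∙-congˡ (interval-split s T (index n) (gap n)) ⟩
      val y ∙ (val (interval s T (index n)) ∙ val (interval s (suc (index n) + T) (gap n)))
        ≈⟨ assoc _ _ _ ⟨
      (val y ∙ val (interval s T (index n))) ∙ val (interval s (suc (index n) + T) (gap n))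
        ≈⟨ ∙-congʳ (holds n) ⟨
      val x ∙ val (interval s (suc (index n) + T) (gap n)) ∎)

module NonAbsorbing (em : ∀ {a} → ExcludedMiddle a) {c ℓ} (S : Semigroup c ℓ) (a : ℕ → Semigroup.Carrier S)
                    (s : Sumsequences.Sumseq S a) (¬absorber : ¬ Sumsequences.Absorber S a s) where
  open Semigroup S using (_≈_; _∙_; reflexive; ∙-cong; ∙-congʳ) renaming (sym to ≈-sym; trans to ≈-trans)
  open Sumsequences S a
  open Sumseq
  open Classical em

  -- A relation g = h + bₙ with g, h ∈ FS(b₀,…,bₙ₋₁), where b = group s f and l = f n.
  Collision : (ℕ → ℕ) → ℕ → ℕ → Set ℓ
  Collision f n l = ∃ λ G → ∃ λ H → maxF G < n × maxF H < n ×
    sumF S (term (group s f)) G ≈ sumF S (term (group s f)) H ∙ val (interval s (groupStart s f n) l)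

  module _ {f g : ℕ → ℕ} where

    groupStart-local : ∀ {n} → (∀ k → k < n → f k ≡ g k) → groupStart s f n ≡ groupStart s g n
    groupStart-local {zero}  _   = refl
    groupStart-local {suc n} f≡g =
      cong₂ (λ l t → suc l + t) (f≡g n ≤-refl) (groupStart-local (λ k k<n → f≡g k (m<n⇒m<1+n k<n)))

    collision-local : ∀ {n l} → (∀ k → k < n → f k ≡ g k) → Collision f n l → Collision g n l
    collision-local {n} {l} f≡g (G , H , G<n , H<n , G≈H+b) = G , H , G<n , H<n ,
      ≈-trans (reflexive (sym (sumF-local terms≡ G G<n)))
        (≈-trans G≈H+b (∙-cong (reflexive (sumF-local terms≡ H H<n))
                               (reflexive (cong (λ t → val (interval s t l)) (groupStart-local f≡g)))))
      where
      terms≡ : ∀ k → k < n → term (group s f) k ≡ term (group s g) k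
      terms≡ k k<n = cong₂ (λ t l → val (interval s t l))
                       (groupStart-local (λ j j<k → f≡g j (<-trans j<k k<n))) (f≡g k k<n)

  -- By pigeonhole some pair of finite sums collides for infinitely many l.
  absorber-from-collisions : ∀ f n → (∀ l → Collision f n l) → Absorber s
  absorber-from-collisions f n collides =
    absorber-from-recurrence s T x y (≤-reflexive (cong (bound (group s f)) (+-identityʳ n)))
      (generated-⊆ (λ k → interval-generated s (groupStart s f k) (f k)) (proj₁ (proj₂ (recurs 0))))
      (infOften-map {P = λ l → Recurs l x y} proj₂ recurs)
    where
    T = groupStart s f n
    sums = finiteSums (group s f) 0 n

    Recurs : ℕ → (x y : Block (bound s 0) (bound s (groupStart s f (n + 0)))) → Set (c ⊔ ℓ)
    Recurs l x y = Represents (group s f) (val y ∙ val (interval s T l)) x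

    represent : ∀ G → maxF G < n → Any (Represents (group s f) (sumF S (term (group s f)) G)) sums
    represent G G<n =
      finiteSums-complete (group s f) n 0 G z≤n (subst (maxF G <_) (sym (+-identityʳ n)) G<n)

    pairs : ∀ l → Any (λ x → Any (Recurs l x) sums) sums
    pairs l with collides l
    ... | G , H , G<n , H<n , G≈H+b =
      Any.map (λ (gx , x≈G) →
                 Any.map (λ (_ , y≈H) → gx , ≈-trans x≈G (≈-trans G≈H+b (∙-congʳ (≈-sym y≈H))))
                         (represent H H<n))
              (represent G G<n)

    recurringPair : ∃ λ x → ∃ λ y → InfOften (λ l → Recurs l x y)
    recurringPair
      with satisfied (infOften-Any {R = λ l x → Any (Recurs l x) sums} (λ m → 0 , pairs (m + 0)))
    ... | x , infx with satisfied (infOften-Any {R = λ l y → Recurs l x y} infx)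
    ...   | y , infxy = x , y , infxy

    x = proj₁ recurringPair
    y = proj₁ (proj₂ recurringPair)
    recurs = proj₂ (proj₂ recurringPair)

  separating-length : ∀ f n → ∃ λ l → ¬ Collision f n l
  separating-length f n = dne λ ¬separating →
    ¬absorber (absorber-from-collisions f n λ l → dne λ ¬collides → ¬separating (l , ¬collides))

  open PrefixChoice (λ f n l → ¬ Collision f n l)
                    (λ {_} {_} {_} {l} f≡g ¬collides collides →
                       ¬collides (collision-local {l = l} (λ k k<n → sym (f≡g k k<n)) collides))
                    separating-length 0

  nonAbsorbing⇒type2 : Σ Sumseq λ t → Type2 S (term t)
  nonAbsorbing⇒type2 = group s choice , λ n G H G<n H<n eq → choice-spec n (G , H , G<n , H<n , eq)

lemma5p1 : (em : ∀ {a} → ExcludedMiddle a) →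
           ∀ {c ℓ} (S : Semigroup c ℓ) (a : ℕ → Semigroup.Carrier S) →
           Σ (ℕ → FinSet⁺) λ F → Blocks S F ×
             (Type1 S (sumseq S a F) ⊎ Type2 S (sumseq S a F))
lemma5p1 em S a = case em {P = ∃ λ s → ¬ Absorber s} of λ where
    (yes (s , ¬absorber)) →
      let t , type2 = NonAbsorbing.nonAbsorbing⇒type2 em S a s ¬absorber
      in blockSets t , blockSets-blocks t , inj₂ type2
    (no ¬nonAbsorbing) →
      let t , type1 = absorbers⇒type1 λ s → dne λ ¬absorber → ¬nonAbsorbing (s , ¬absorber)
      in blockSets t , blockSets-blocks t , inj₁ type1
  where
  open Sumsequences S a
  open Classical em
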